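{- Let $C_1$ and $C_2$ be strongly connected components in $\mathrm{PA}^*_{01}$, both having alive exit states. Then $C_1\parallel C_2$ is a strongly connected component that has alive exit states, and for all $p\in C_1$ and $q\in C_2$, $\mathrm{Ext}_n(p\parallel q)=(\mathrm{Ext}_n(p)\parallel q)\cup(p\parallel \mathrm{Ext}_n(q))$.
   Context: Fix a non-empty set $A$ of actions. $\mathrm{PA}^*_{01}$ expressions are generated by $p ::= \mathbf{0} \mid \mathbf{1} \mid a \mid p\cdot p \mid p+p \mid p^* \mid p\parallel p$ with $a\in A$ (equality is syntactic identity). The transition relation $p\xrightarrow{a}p'$ and termination predicate $p\downarrow$ are the least relations such that: $\mathbf{1}\downarrow$; $a\xrightarrow{a}\mathbf{1}$; if $p\xrightarrow{a}p'$ then $p+q\xrightarrow{a}p'$ and $q+p\xrightarrow{a}p'$; if $p\downarrow$ then $(p+q)\downarrow$ and $(q+p)\downarrow$; if $p\xrightarrow{a}p'$ then $p\cdot q\xrightarrow{a}p'\cdot q$; if $p\downarrow$ and $q\xrightarrow{a}q'$ then $p\cdot q\xrightarrow{a}q'$; if $p\downarrow$ and $q\downarrow$ then $(p\cdot q)\downarrow$; if $p\xrightarrow{a}p'$ then $p^*\xrightarrow{a}p'\cdot p^*$; $p^*\downarrow$; if $p\xrightarrow{a}p'$ then $p\parallel q\xrightarrow{a}p'\parallel q$; if $q\xrightarrow{a}q'$ then $p\parallel q\xrightarrow{a}p\parallel q'$; if $p\downarrow$ and $q\downarrow$ then $(p\parallel q)\downarrow$. Write $p\to q$ if $p\xrightarrow{a}q$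 for some $a$, and $\to^*$ for its reflexive-transitive closure. A strongly connected component is a maximal set $C$ of expressions with $s\to^* s'$ for all $s,s'\in C$. $C_1\parallel C_2=\{p\parallel q\mid p\in C_1,q\in C_2\}$. An expression $s$ is normed if $s\to^* s'$ for some $s'$ with $s'\downarrow$. For $s$ in a strongly connected component $C$, $\mathrm{Ext}_n(s)=\{(a,s')\mid s\xrightarrow{a}s',\ s'\notin C,\ s'\text{ normed}\}$ (relative to the component containing $s$); $s\in C$ is an alive exit state if $s\downarrow$ or $\mathrm{Ext}_n(s)\neq\emptyset$. For a set $E$ of pairs and an expression $p$, $E\parallel p=\{(a,q\parallel p)\mid (a,q)\in E\}$ and $p\parallel E=\{(a,p\parallel q)\mid (a,q)\in E\}$. -}

module Defs where

open import Level using (0ℓ)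
open import Data.Product using (Σ; ∃; _×_; _,_)
open import Data.Sum using (_⊎_)
open import Relation.Nullary using (¬_)
open import Relation.Unary using (Pred; _∈_; _⊆_)
open import Relation.Binary.PropositionalEquality using (_≡_)
open import Relation.Binary.Construct.Closure.ReflexiveTransitive using (Star)
open import Function.Bundles using (_⇔_)

data Exp (A : Set) : Set where
  𝟘 𝟙  : Exp A
  act  : A → Exp A
  _·_  : Exp A → Exp A → Exp A
  _+_  : Exp A → Exp A → Exp A
  _*   : Exp A → Exp A
  _∥_  : Exp A → Exp A → Exp A

module _ {A : Set} where

  data _↓ : Exp A → Set
  data _─_⟶_ : Exp A → A → Exp A → Set

  data _↓ where
    𝟙↓  : 𝟙 ↓
    +↓ˡ : ∀ {p q} → p ↓ → (p + q) ↓
    +↓ʳ : ∀ {p q} → q ↓ → (p + q) ↓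
    ·↓  : ∀ {p q} → p ↓ → q ↓ → (p · q) ↓
    *↓  : ∀ {p} → (p *) ↓
    ∥↓  : ∀ {p q} → p ↓ → q ↓ → (p ∥ q) ↓

  data _─_⟶_ where
    act⟶ : ∀ {a} → act a ─ a ⟶ 𝟙
    +⟶ˡ  : ∀ {p q a p'} → p ─ a ⟶ p' → (p + q) ─ a ⟶ p'
    +⟶ʳ  : ∀ {p q a p'} → p ─ a ⟶ p' → (q + p) ─ a ⟶ p'
    ·⟶ˡ  : ∀ {p q a p'} → p ─ a ⟶ p' → (p · q) ─ a ⟶ (p' · q)
    ·⟶ʳ  : ∀ {p q a q'} → p ↓ → q ─ a ⟶ q' → (p · q) ─ a ⟶ q'
    *⟶   : ∀ {p a p'} → p ─ a ⟶ p' → (p *) ─ a ⟶ (p' · (p *))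
    ∥⟶ˡ  : ∀ {p q a p'} → p ─ a ⟶ p' → (p ∥ q) ─ a ⟶ (p' ∥ q)
    ∥⟶ʳ  : ∀ {p q a q'} → q ─ a ⟶ q' → (p ∥ q) ─ a ⟶ (p ∥ q')

  _⟶_ : Exp A → Exp A → Set
  p ⟶ q = Σ A (λ a → p ─ a ⟶ q)

  _⟶*_ : Exp A → Exp A → Set
  _⟶*_ = Star _⟶_

  StronglyConnected : Pred (Exp A) 0ℓ → Set
  StronglyConnected C = ∀ {s s'} → s ∈ C → s' ∈ C → s ⟶* s'

  IsSCC : Pred (Exp A) 0ℓ → Set₁
  IsSCC C = StronglyConnected C
          × (∀ (D : Pred (Exp A) 0ℓ) → StronglyConnected D → C ⊆ D → D ⊆ C)

  _∥ˢ_ : Pred (Exp A) 0ℓ → Pred (Exp A) 0ℓ → Pred (Exp A) 0ℓ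
  (C₁ ∥ˢ C₂) r = Σ (Exp A) λ p → Σ (Exp A) λ q → r ≡ (p ∥ q) × p ∈ C₁ × q ∈ C₂

  Normed : Exp A → Set
  Normed s = Σ (Exp A) λ s' → s ⟶* s' × s' ↓

  -- Ext_n(s) relative to the component C containing s, as a predicate on pairs (a , s')
  Extₙ : Pred (Exp A) 0ℓ → Exp A → A → Exp A → Set
  Extₙ C s a s' = s ─ a ⟶ s' × ¬ (s' ∈ C) × Normed s'

  AliveExit : Pred (Exp A) 0ℓ → Exp A → Set
  AliveExit C s = s ↓ ⊎ (Σ A λ a → Σ (Exp A) λ s' → Extₙ C s a s')

  HasAliveExit : Pred (Exp A) 0ℓ → Set
  HasAliveExit C = Σ (Exp A) λ s → s ∈ C × AliveExit C s

module Submission where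

-- A run of p ∥ q is an interleaving of a run of p and a run of q, so p ∥ q
-- reaches x ∥ y exactly when p reaches x and q reaches y, and it terminates
-- exactly when both components do. Hence C₁ ∥ C₂ is strongly connected, and it
-- is maximal because anything mutually reachable with a point of C₁ ∥ C₂ splits
-- into components mutually reachable with points of C₁ and C₂. A step of p ∥ q
-- moves one side only and leaves C₁ ∥ C₂ iff that side leaves its component;
-- the other side stays normed since every element of a component with an alive
-- exit state is normed.

open import Defs
open import Level using (0ℓ)
open import Data.Product using (Σ; _×_; _,_; proj₁; proj₂)
open import Data.Sum using (_⊎_; inj₁; inj₂)
open import Relation.Unary using (Pred; _∈_; _∉_; _⊆_; Satisfiable)
open import Relation.Binary.PropositionalEquality using (_≡_; refl)
open import Function.Bundles using (_⇔_; mk⇔)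
open import Relation.Binary.Construct.Closure.ReflexiveTransitive using (ε; _◅_; _◅◅_)

module _ {A : Set} where

  ⟶*-∥ˡ : ∀ {p p' q : Exp A} → p ⟶* p' → (p ∥ q) ⟶* (p' ∥ q)
  ⟶*-∥ˡ ε                = ε
  ⟶*-∥ˡ ((a , t) ◅ ts) = (a , ∥⟶ˡ t) ◅ ⟶*-∥ˡ ts

  ⟶*-∥ʳ : ∀ {p q q' : Exp A} → q ⟶* q' → (p ∥ q) ⟶* (p ∥ q')
  ⟶*-∥ʳ ε                = ε
  ⟶*-∥ʳ ((a , t) ◅ ts) = (a , ∥⟶ʳ t) ◅ ⟶*-∥ʳ ts

  ⟶*-∥ : ∀ {p p' q q' : Exp A} → p ⟶* p' → q ⟶* q' → (p ∥ q) ⟶* (p' ∥ q')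
  ⟶*-∥ ps qs = ⟶*-∥ˡ ps ◅◅ ⟶*-∥ʳ qs

  ⟶*-from-∥ : ∀ {p q r : Exp A} → (p ∥ q) ⟶* r →
    Σ (Exp A) λ x → Σ (Exp A) λ y → r ≡ (x ∥ y) × p ⟶* x × q ⟶* y
  ⟶*-from-∥ ε = _ , _ , refl , ε , ε
  ⟶*-from-∥ ((a , ∥⟶ˡ t) ◅ ts) with ⟶*-from-∥ ts
  ... | x , y , refl , px , qy = x , y , refl , (a , t) ◅ px , qy
  ⟶*-from-∥ ((a , ∥⟶ʳ t) ◅ ts) with ⟶*-from-∥ ts
  ... | x , y , refl , px , qy = x , y , refl , px , (a , t) ◅ qy

  ⟶*-∥⁻¹ : ∀ {p p' q q' : Exp A} → (p ∥ q) ⟶* (p' ∥ q') → p ⟶* p' × q ⟶* q'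
  ⟶*-∥⁻¹ ts with ⟶*-from-∥ ts
  ... | _ , _ , refl , ps , qs = ps , qs

  isSCC-closed : ∀ {C : Pred (Exp A) 0ℓ} {p x} →
    IsSCC C → p ∈ C → p ⟶* x → x ⟶* p → x ∈ C
  isSCC-closed {C} {p} {x} (sc , maximal) p∈C px xp = maximal C∪x sc-C∪x inj₁ (inj₂ refl)
    where
    C∪x : Pred (Exp A) 0ℓ
    C∪x y = y ∈ C ⊎ y ≡ x

    sc-C∪x : StronglyConnected C∪x
    sc-C∪x (inj₁ s∈C)  (inj₁ s'∈C) = sc s∈C s'∈C
    sc-C∪x (inj₁ s∈C)  (inj₂ refl) = sc s∈C p∈C ◅◅ px
    sc-C∪x (inj₂ refl) (inj₁ s'∈C) = xp ◅◅ sc p∈C s'∈C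
    sc-C∪x (inj₂ refl) (inj₂ refl) = ε

  ∥ˢ-stronglyConnected : ∀ {C₁ C₂ : Pred (Exp A) 0ℓ} →
    StronglyConnected C₁ → StronglyConnected C₂ → StronglyConnected (C₁ ∥ˢ C₂)
  ∥ˢ-stronglyConnected sc₁ sc₂ (_ , _ , refl , p∈C₁ , q∈C₂) (_ , _ , refl , p'∈C₁ , q'∈C₂) =
    ⟶*-∥ (sc₁ p∈C₁ p'∈C₁) (sc₂ q∈C₂ q'∈C₂)

  ∥ˢ-closed : ∀ {C₁ C₂ : Pred (Exp A) 0ℓ} {p q r} → IsSCC C₁ → IsSCC C₂ →
    p ∈ C₁ → q ∈ C₂ → (p ∥ q) ⟶* r → r ⟶* (p ∥ q) → r ∈ (C₁ ∥ˢ C₂)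
  ∥ˢ-closed scc₁ scc₂ p∈C₁ q∈C₂ pq⟶*r r⟶*pq with ⟶*-from-∥ pq⟶*r
  ... | x , y , refl , px , qy with ⟶*-∥⁻¹ r⟶*pq
  ... | xp , yq = x , y , refl , isSCC-closed scc₁ p∈C₁ px xp , isSCC-closed scc₂ q∈C₂ qy yq

  ∥ˢ-isSCC : ∀ {C₁ C₂ : Pred (Exp A) 0ℓ} →
    IsSCC C₁ → IsSCC C₂ → Satisfiable C₁ → Satisfiable C₂ → IsSCC (C₁ ∥ˢ C₂)
  ∥ˢ-isSCC {C₁} {C₂} scc₁@(sc₁ , _) scc₂@(sc₂ , _) (s₁ , s₁∈C₁) (s₂ , s₂∈C₂) =
    ∥ˢ-stronglyConnected sc₁ sc₂ , maximal
    where
    maximal : ∀ D → StronglyConnected D → (C₁ ∥ˢ C₂) ⊆ D → D ⊆ (C₁ ∥ˢ C₂)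
    maximal D scD C₁∥C₂⊆D r∈D = ∥ˢ-closed scc₁ scc₂ s₁∈C₁ s₂∈C₂ (scD s∈D r∈D) (scD r∈D s∈D)
      where
      s∈D : (s₁ ∥ s₂) ∈ D
      s∈D = C₁∥C₂⊆D (s₁ , s₂ , refl , s₁∈C₁ , s₂∈C₂)

  normed-⟵* : ∀ {p q : Exp A} → p ⟶* q → Normed q → Normed p
  normed-⟵* pq (t , qt , t↓) = t , pq ◅◅ qt , t↓

  normed-∥ : ∀ {p q : Exp A} → Normed p → Normed q → Normed (p ∥ q)
  normed-∥ (x , px , x↓) (y , qy , y↓) = x ∥ y , ⟶*-∥ px qy , ∥↓ x↓ y↓

  normed-∥⁻¹ : ∀ {p q : Exp A} → Normed (p ∥ q) → Normed p × Normed q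
  normed-∥⁻¹ (t , pq⟶*t , t↓) with ⟶*-from-∥ pq⟶*t
  normed-∥⁻¹ (_ , _ , ∥↓ x↓ y↓) | x , y , refl , px , qy = (x , px , x↓) , (y , qy , y↓)

  aliveExit⇒normed : ∀ {C : Pred (Exp A) 0ℓ} {s} → AliveExit C s → Normed s
  aliveExit⇒normed (inj₁ s↓)                           = _ , ε , s↓
  aliveExit⇒normed (inj₂ (a , s' , t , _ , s'-normed)) = normed-⟵* ((a , t) ◅ ε) s'-normed

  hasAliveExit⇒normed : ∀ {C : Pred (Exp A) 0ℓ} {q} →
    StronglyConnected C → HasAliveExit C → q ∈ C → Normed q
  hasAliveExit⇒normed sc (s , s∈C , alive) q∈C =
    normed-⟵* (sc q∈C s∈C) (aliveExit⇒normed alive)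

  module _ {C₁ C₂ : Pred (Exp A) 0ℓ} where

    ∥ˢ-∉ˡ : ∀ {p q} → p ∉ C₁ → (p ∥ q) ∉ (C₁ ∥ˢ C₂)
    ∥ˢ-∉ˡ p∉C₁ (_ , _ , refl , p∈C₁ , _) = p∉C₁ p∈C₁

    ∥ˢ-∉ʳ : ∀ {p q} → q ∉ C₂ → (p ∥ q) ∉ (C₁ ∥ˢ C₂)
    ∥ˢ-∉ʳ q∉C₂ (_ , _ , refl , _ , q∈C₂) = q∉C₂ q∈C₂

    Extₙ-∥ˡ : ∀ {p q a p'} → Normed q → Extₙ C₁ p a p' → Extₙ (C₁ ∥ˢ C₂) (p ∥ q) a (p' ∥ q)
    Extₙ-∥ˡ q-normed (t , p'∉C₁ , p'-normed) =
      ∥⟶ˡ t , ∥ˢ-∉ˡ p'∉C₁ , normed-∥ p'-normed q-normed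

    Extₙ-∥ʳ : ∀ {p q a q'} → Normed p → Extₙ C₂ q a q' → Extₙ (C₁ ∥ˢ C₂) (p ∥ q) a (p ∥ q')
    Extₙ-∥ʳ p-normed (t , q'∉C₂ , q'-normed) =
      ∥⟶ʳ t , ∥ˢ-∉ʳ q'∉C₂ , normed-∥ p-normed q'-normed

    Extₙ-∥⁻¹ : ∀ {p q a r} → p ∈ C₁ → q ∈ C₂ → Extₙ (C₁ ∥ˢ C₂) (p ∥ q) a r
      → (Σ (Exp A) λ p' → r ≡ (p' ∥ q) × Extₙ C₁ p a p')
      ⊎ (Σ (Exp A) λ q' → r ≡ (p ∥ q') × Extₙ C₂ q a q')
    Extₙ-∥⁻¹ {p} {q} p∈C₁ q∈C₂ (∥⟶ˡ {p' = p'} t , r∉C , r-normed) =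
      inj₁ (p' , refl , t , (λ p'∈C₁ → r∉C (p' , q , refl , p'∈C₁ , q∈C₂))
                           , proj₁ (normed-∥⁻¹ r-normed))
    Extₙ-∥⁻¹ {p} {q} p∈C₁ q∈C₂ (∥⟶ʳ {q' = q'} t , r∉C , r-normed) =
      inj₂ (q' , refl , t , (λ q'∈C₂ → r∉C (p , q' , refl , p∈C₁ , q'∈C₂))
                           , proj₂ (normed-∥⁻¹ r-normed))

    aliveExit-∥ : ∀ {p q} → AliveExit C₁ p → AliveExit C₂ q → AliveExit (C₁ ∥ˢ C₂) (p ∥ q)
    aliveExit-∥ (inj₁ p↓) (inj₁ q↓) = inj₁ (∥↓ p↓ q↓)
    aliveExit-∥ alive₁ (inj₂ (a , q' , e)) =
      inj₂ (a , _ , Extₙ-∥ʳ (aliveExit⇒normed alive₁) e)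
    aliveExit-∥ (inj₂ (a , p' , e)) alive₂ =
      inj₂ (a , _ , Extₙ-∥ˡ (aliveExit⇒normed alive₂) e)

    hasAliveExit-∥ˢ : HasAliveExit C₁ → HasAliveExit C₂ → HasAliveExit (C₁ ∥ˢ C₂)
    hasAliveExit-∥ˢ (p , p∈C₁ , alive₁) (q , q∈C₂ , alive₂) =
      p ∥ q , (p , q , refl , p∈C₁ , q∈C₂) , aliveExit-∥ alive₁ alive₂

lemma32 : {A : Set} → A → (C₁ C₂ : Pred (Exp A) 0ℓ)
    → IsSCC C₁ → IsSCC C₂ → HasAliveExit C₁ → HasAliveExit C₂
    → IsSCC (C₁ ∥ˢ C₂)
      × HasAliveExit (C₁ ∥ˢ C₂)
      × (∀ p q → p ∈ C₁ → q ∈ C₂ → ∀ (a : A) (r : Exp A)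
          → Extₙ (C₁ ∥ˢ C₂) (p ∥ q) a r
            ⇔ ((Σ (Exp A) λ p' → r ≡ (p' ∥ q) × Extₙ C₁ p a p')
               ⊎ (Σ (Exp A) λ q' → r ≡ (p ∥ q') × Extₙ C₂ q a q')))
lemma32 _ C₁ C₂ scc₁@(sc₁ , _) scc₂@(sc₂ , _) alive₁@(s₁ , s₁∈C₁ , _) alive₂@(s₂ , s₂∈C₂ , _) =
  ∥ˢ-isSCC scc₁ scc₂ (s₁ , s₁∈C₁) (s₂ , s₂∈C₂) ,
  hasAliveExit-∥ˢ alive₁ alive₂ ,
  λ p q p∈C₁ q∈C₂ a r → mk⇔ (Extₙ-∥⁻¹ p∈C₁ q∈C₂) λ where
    (inj₁ (_ , refl , e)) → Extₙ-∥ˡ (hasAliveExit⇒normed sc₂ alive₂ q∈C₂) e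
    (inj₂ (_ , refl , e)) → Extₙ-∥ʳ (hasAliveExit⇒normed sc₁ alive₁ p∈C₁) e
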